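{- Let $G$ be a graph. Then the cycle matroid $M(G)$ is saturated.
   Context: $M(G)$ is the cycle matroid of $G$. A flat $F$ of a matroid $M$ is modular if $r(F)+r(F')=r(F\cap F')+r(F\cup F')$ for every flat $F'$. A vertical cover of $M$ is a pair of flats $(F_1,F_2)$, neither equal to $E(M)$, with $F_1\cup F_2=E(M)$; a flat $F$ is round if $M|F$ has no vertical cover. A matroid is saturated if every round flat is modular. -}

module Defs where

open import Data.Nat using (ℕ; _+_; _≤_; _<_)
open import Data.Fin using (Fin)
open import Data.Fin.Subset using (Subset; _∈_; _∉_; _⊆_; _∪_; _∩_; ⊤; ⁅_⁆; ∣_∣)
open import Data.Product using (Σ; _×_; _,_)
open import Data.Sum using (_⊎_)
open import Data.List using (List; []; _∷_)
open import Data.List.Relation.Unary.All using (All)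
open import Data.List.Relation.Unary.Unique.Propositional using (Unique)
open import Relation.Binary.PropositionalEquality using (_≡_; _≢_)
open import Relation.Nullary using (¬_)

-- Finite graphs (loops and parallel edges allowed):
-- vertex set Fin n, edge set Fin m, each edge has two ends.

record Graph : Set where
  field
    nV   : ℕ
    nE   : ℕ
    ends : Fin nE → Fin nV × Fin nV

module _ (G : Graph) where
  open Graph G

  Joins : Fin nE → Fin nV → Fin nV → Set
  Joins e u w = (ends e ≡ (u , w)) ⊎ (ends e ≡ (w , u))

  data Walk : Fin nV → Fin nV → List (Fin nE) → Set where
    nil  : ∀ {u} → Walk u u []
    cons : ∀ {u w v e es} → Joins e u w → Walk w v es → Walk u v (e ∷ es)

  HasCycle : Subset nE → Set
  HasCycle X = Σ (Fin nV) λ u → Σ (Fin nE) λ e → Σ (List (Fin nE)) λ es →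
    Walk u u (e ∷ es) × Unique (e ∷ es) × All (_∈ X) (e ∷ es)

  CycleIndep : Subset nE → Set
  CycleIndep X = ¬ HasCycle X

module MatroidNotions {m : ℕ} (Indep : Subset m → Set) where

  Rank : Subset m → ℕ → Set
  Rank X k =
    (Σ (Subset m) λ I → I ⊆ X × Indep I × ∣ I ∣ ≡ k) ×
    (∀ I → I ⊆ X → Indep I → ∣ I ∣ ≤ k)

  -- X is a flat of the restriction M|F (rank of M|F is rank of M on subsets of F)
  FlatIn : Subset m → Subset m → Set
  FlatIn F X = X ⊆ F × (∀ e → e ∈ F → e ∉ X →
    ∀ a b → Rank X a → Rank (X ∪ ⁅ e ⁆) b → a < b)

  Flat : Subset m → Set
  Flat X = FlatIn ⊤ X

  VerticalCoverIn : Subset m → Subset m → Subset m → Set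
  VerticalCoverIn F F₁ F₂ =
    FlatIn F F₁ × FlatIn F F₂ × F₁ ≢ F × F₂ ≢ F × (F₁ ∪ F₂) ≡ F

  Round : Subset m → Set
  Round F = Flat F × (∀ F₁ F₂ → ¬ VerticalCoverIn F F₁ F₂)

  Modular : Subset m → Set
  Modular F = Flat F × (∀ F' → Flat F' → ∀ a b c d →
    Rank F a → Rank F' b → Rank (F ∩ F') c → Rank (F ∪ F') d →
    a + b ≡ c + d)

  Saturated : Set
  Saturated = ∀ F → Round F → Modular F

CycleMatroidSaturated : Graph → Set
CycleMatroidSaturated G = MatroidNotions.Saturated (CycleIndep G)

-- Ranks in M(G) are r(X) = |V| − c(X), where c(X) is the number of components of the spanning
-- subgraph (V, X); so modularity of a flat F is the identity c(F) + c(F′) = c(F ∩ F′) + c(F ∪ F′).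
-- If F is round, any two vertices incident with non-loop edges of F are adjacent in F: otherwise
-- deleting the non-loop edges at either vertex gives two proper flats of M|F covering F. Now add the
-- edges of F one at a time to both F ∩ F′ and F′. Two such vertices connected in F′ plus the edges
-- added so far are also connected in F ∩ F′ plus those edges: the pieces of the connection inside F′
-- run between such vertices, so they can be replaced by edges of F, which lie in the flat F′. Hence
-- both component counts drop at exactly the same steps, which gives the identity.
module Submission where

open import Defs
open import Level using (0ℓ)
open import Function using (_∘_; id)
open import Data.Bool using (if_then_else_)
open import Data.Nat as ℕ using (ℕ; zero; suc; _+_; z≤n; s≤s)
import Data.Nat.Properties as ℕ
open import Algebra.Properties.CommutativeSemigroup ℕ.+-commutativeSemigroup using (interchange)
open import Data.Fin using (Fin; zero; suc; _<_)
open import Data.Fin.Properties using (_≟_; <-cmp; _<?_; all?; <-trans; <⇒≢; suc-injective)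
  renaming (any? to ∃?)
open import Data.Fin.Subset using (Subset; inside; outside; _∈_; _∉_; _⊆_; _∪_; _∩_; ⁅_⁆; ⊥; ∣_∣)
open import Data.Fin.Subset.Properties
  using (_∈?_; ∉⊥; ∈⊤; ∣⊥∣≡0; ⊆-antisym; x∈⁅x⁆; x∈⁅y⁆⇒x≡y; x∈p∪q⁺; x∈p∪q⁻; p⊆p∪q; q⊆p∪q;
         x∈p∩q⁺; p∩q⊆p; p∩q⊆q; ∪-identityˡ; ∪-identityʳ; ∪-comm)
open import Data.List using (List; _∷_; []; filter; allFin)
open import Data.List.Membership.Propositional using () renaming (_∈_ to _∈ₗ_; _∉_ to _∉ₗ_)
open import Data.List.Membership.Propositional.Properties using (∈-filter⁺; ∈-filter⁻; ∈-allFin)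
open import Data.List.Relation.Unary.All as All using (All; []; _∷_)
open import Data.List.Relation.Unary.All.Properties using (¬Any⇒All¬)
open import Data.List.Relation.Unary.AllPairs using ([]; _∷_)
open import Data.List.Relation.Unary.Any using (any?) renaming (here to hereₗ; there to thereₗ)
open import Data.List.Relation.Unary.Unique.Propositional using (Unique)
open import Data.Product using (∃; _×_; _,_; proj₁; proj₂)
open import Data.Sum using (_⊎_; inj₁; inj₂)
open import Data.Vec using (_∷_; []; here; there)
open import Relation.Binary using (Rel; Decidable; IsEquivalence; _⇒_; tri<; tri≈; tri>)
open import Relation.Binary.Construct.Closure.ReflexiveTransitive as Star using (Star; ε; _◅_; _◅◅_)
open import Relation.Binary.PropositionalEquality
  using (_≡_; _≢_; refl; sym; trans; cong; cong₂; subst; subst₂; module ≡-Reasoning)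
open import Relation.Nullary using (¬_; Dec; yes; no; does; contradiction)
open import Relation.Nullary.Decidable using (_⊎-dec_; _×-dec_; ¬?; _→-dec_; map′; decidable-stable)
open import Relation.Unary as U using (Pred)

-- Counting and equivalence classes on Fin n

count : ∀ {n} {P : Pred (Fin n) 0ℓ} → U.Decidable P → ℕ
count {zero}  P? = 0
count {suc n} P? = (if does (P? zero) then suc else id) (count (P? ∘ suc))

count-mono : ∀ {n} {P Q : Pred (Fin n) 0ℓ} (P? : U.Decidable P) (Q? : U.Decidable Q) →
             (∀ {i} → P i → Q i) → count P? ℕ.≤ count Q?
count-mono {zero}  P? Q? P⊆Q = z≤n
count-mono {suc n} P? Q? P⊆Q with P? zero | Q? zero
... | yes _ | yes _  = s≤s (count-mono (P? ∘ suc) (Q? ∘ suc) P⊆Q)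
... | yes p | no ¬q  = contradiction (P⊆Q p) ¬q
... | no _  | yes _  = ℕ.m≤n⇒m≤1+n (count-mono (P? ∘ suc) (Q? ∘ suc) P⊆Q)
... | no _  | no _   = count-mono (P? ∘ suc) (Q? ∘ suc) P⊆Q

count-cong : ∀ {n} {P Q : Pred (Fin n) 0ℓ} (P? : U.Decidable P) (Q? : U.Decidable Q) →
             (∀ {i} → P i → Q i) → (∀ {i} → Q i → P i) → count P? ≡ count Q?
count-cong P? Q? P⊆Q Q⊆P = ℕ.≤-antisym (count-mono P? Q? P⊆Q) (count-mono Q? P? Q⊆P)

count-all : ∀ {n} {P : Pred (Fin n) 0ℓ} (P? : U.Decidable P) → (∀ i → P i) → count P? ≡ n
count-all {zero}  P? all = refl
count-all {suc n} P? all with P? zero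
... | yes _  = cong suc (count-all (P? ∘ suc) (all ∘ suc))
... | no ¬p0 = contradiction (all zero) ¬p0

count-remove : ∀ {n} {P Q : Pred (Fin n) 0ℓ} (P? : U.Decidable P) (Q? : U.Decidable Q) {x} →
               P x → ¬ Q x → (∀ {i} → Q i → P i) → (∀ {i} → P i → i ≢ x → Q i) →
               count P? ≡ suc (count Q?)
count-remove {suc n} P? Q? {zero} px ¬qx Q⊆P P⊆Q with P? zero | Q? zero
... | yes _ | no _   = cong suc (count-cong (P? ∘ suc) (Q? ∘ suc) (λ p → P⊆Q p λ ()) Q⊆P)
... | no ¬p | _      = contradiction px ¬p
... | _     | yes q  = contradiction q ¬qx
count-remove {suc n} P? Q? {suc x} px ¬qx Q⊆P P⊆Q with P? zero | Q? zero
... | yes _ | yes _  = cong suc (count-remove (P? ∘ suc) (Q? ∘ suc) px ¬qx Q⊆P (λ p → P⊆Q p ∘ (_∘ suc-injective)))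
... | no _  | no _   = count-remove (P? ∘ suc) (Q? ∘ suc) px ¬qx Q⊆P (λ p → P⊆Q p ∘ (_∘ suc-injective))
... | yes p | no ¬q  = contradiction (P⊆Q p (λ ())) ¬q
... | no ¬p | yes q  = contradiction (Q⊆P q) ¬p

least : ∀ {n} {P : Pred (Fin n) 0ℓ} → U.Decidable P → ∀ {x} → P x →
        ∃ λ a → P a × (∀ w → w < a → ¬ P w)
least {suc n} P? px with P? zero
... | yes p0 = zero , p0 , λ w ()
least {suc n} P? {zero}  px | no ¬p0 = contradiction px ¬p0
least {suc n} P? {suc x} px | no ¬p0 with least (P? ∘ suc) px
... | a , pa , below = suc a , pa , below′
  where
  below′ : ∀ w → w < suc a → ¬ _
  below′ zero    _         = ¬p0
  below′ (suc w) (s≤s w<a) = below w w<a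

-- The classes of an equivalence relation on Fin n are counted through their least elements.
LeastInClass : ∀ {n} → Rel (Fin n) 0ℓ → Pred (Fin n) 0ℓ
LeastInClass R v = ∀ u → u < v → ¬ R u v

leastInClass? : ∀ {n} {R : Rel (Fin n) 0ℓ} → Decidable R → U.Decidable (LeastInClass R)
leastInClass? R? v = all? λ u → u <? v →-dec ¬? (R? u v)

#classes : ∀ {n} {R : Rel (Fin n) 0ℓ} → Decidable R → ℕ
#classes R? = count (leastInClass? R?)

#classes-antitone : ∀ {n} {R S : Rel (Fin n) 0ℓ} (R? : Decidable R) (S? : Decidable S) →
                    R ⇒ S → #classes S? ℕ.≤ #classes R?
#classes-antitone R? S? R⇒S = count-mono (leastInClass? S?) (leastInClass? R?)
  λ leastS u u<v → leastS u u<v ∘ R⇒S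

#classes-cong : ∀ {n} {R S : Rel (Fin n) 0ℓ} (R? : Decidable R) (S? : Decidable S) →
                R ⇒ S → S ⇒ R → #classes R? ≡ #classes S?
#classes-cong R? S? R⇒S S⇒R =
  ℕ.≤-antisym (#classes-antitone S? R? S⇒R) (#classes-antitone R? S? R⇒S)

#classes-discrete : ∀ {n} {R : Rel (Fin n) 0ℓ} (R? : Decidable R) → R ⇒ _≡_ → #classes R? ≡ n
#classes-discrete R? R⇒≡ = count-all (leastInClass? R?) λ v u u<v → <⇒≢ u<v ∘ R⇒≡

-- For an equivalence R: the equivalence obtained by gluing the classes of x and y.
Merge : ∀ {a} {A : Set a} → Rel A 0ℓ → A → A → Rel A 0ℓ
Merge R x y u v = R u v ⊎ (R u x × R y v) ⊎ (R u y × R x v)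

merge? : ∀ {a} {A : Set a} {R : Rel A 0ℓ} → Decidable R → ∀ x y → Decidable (Merge R x y)
merge? R? x y u v = R? u v ⊎-dec ((R? u x ×-dec R? y v) ⊎-dec (R? u y ×-dec R? x v))

merge-swap : ∀ {a} {A : Set a} {R : Rel A 0ℓ} {x y} → Merge R x y ⇒ Merge R y x
merge-swap (inj₁ r)               = inj₁ r
merge-swap (inj₂ (inj₁ ux×yv))    = inj₂ (inj₂ ux×yv)
merge-swap (inj₂ (inj₂ uy×xv))    = inj₂ (inj₁ uy×xv)

merge-map : ∀ {a} {A : Set a} {R S : Rel A 0ℓ} (T : Pred A 0ℓ) →
            (∀ {p q} → T p → T q → R p q → S p q) →
            ∀ {x y u v} → T x → T y → T u → T v → Merge R x y u v → Merge S x y u v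
merge-map T f tx ty tu tv (inj₁ uv)               = inj₁ (f tu tv uv)
merge-map T f tx ty tu tv (inj₂ (inj₁ (ux , yv))) = inj₂ (inj₁ (f tu tx ux , f ty tv yv))
merge-map T f tx ty tu tv (inj₂ (inj₂ (uy , xv))) = inj₂ (inj₂ (f tu ty uy , f tx tv xv))

module _ {a} {A : Set a} {R : Rel A 0ℓ} (equiv : IsEquivalence R) where
  open IsEquivalence equiv renaming (trans to _∙_)

  merge-trans : ∀ {x y u w v} → Merge R x y u w → Merge R x y w v → Merge R x y u v
  merge-trans (inj₁ uw)               (inj₁ wv)               = inj₁ (uw ∙ wv)
  merge-trans (inj₁ uw)               (inj₂ (inj₁ (wx , yv))) = inj₂ (inj₁ (uw ∙ wx , yv))
  merge-trans (inj₁ uw)               (inj₂ (inj₂ (wy , xv))) = inj₂ (inj₂ (uw ∙ wy , xv))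
  merge-trans (inj₂ (inj₁ (ux , yw))) (inj₁ wv)               = inj₂ (inj₁ (ux , yw ∙ wv))
  merge-trans (inj₂ (inj₁ (ux , _)))  (inj₂ (inj₁ (_ , yv)))  = inj₂ (inj₁ (ux , yv))
  merge-trans (inj₂ (inj₁ (ux , _)))  (inj₂ (inj₂ (_ , xv)))  = inj₁ (ux ∙ xv)
  merge-trans (inj₂ (inj₂ (uy , xw))) (inj₁ wv)               = inj₂ (inj₂ (uy , xw ∙ wv))
  merge-trans (inj₂ (inj₂ (uy , _)))  (inj₂ (inj₁ (_ , yv)))  = inj₁ (uy ∙ yv)
  merge-trans (inj₂ (inj₂ (uy , _)))  (inj₂ (inj₂ (_ , xv)))  = inj₂ (inj₂ (uy , xv))

module _ {n} {R : Rel (Fin n) 0ℓ} (R? : Decidable R) (equiv : IsEquivalence R) where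
  open IsEquivalence equiv renaming (refl to R-refl; sym to R-sym; trans to _∙_)

  leastInClass-unique : ∀ {v w} → LeastInClass R v → LeastInClass R w → R v w → v ≡ w
  leastInClass-unique {v} {w} least-v least-w vw with <-cmp v w
  ... | tri< v<w _ _ = contradiction vw (least-w v v<w)
  ... | tri≈ _ v≡w _ = v≡w
  ... | tri> _ _ w<v = contradiction (R-sym vw) (least-v w w<v)

  private
    -- The least element b of the class of y stops being least after gluing, as a < b; nothing else changes.
    #classes-merge-< : ∀ {x y a b} → R a x → (∀ w → w < a → ¬ R w x) →
                       R b y → (∀ w → w < b → ¬ R w y) → a < b →
                       #classes R? ≡ suc (#classes (merge? R? x y))
    #classes-merge-< {x} {y} {a} {b} ax below-a by below-b a<b =
      count-remove (leastInClass? R?) (leastInClass? (merge? R? x y))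
        least-b ¬merged-least-b (λ least u u<v → least u u<v ∘ inj₁) stays-least
      where
      least-a : LeastInClass R a
      least-a u u<a ua = below-a u u<a (ua ∙ ax)
      least-b : LeastInClass R b
      least-b u u<b ub = below-b u u<b (ub ∙ by)
      ¬merged-least-b : ¬ LeastInClass (Merge R x y) b
      ¬merged-least-b least = least a a<b (inj₂ (inj₁ (ax , R-sym by)))
      stays-least : ∀ {v} → LeastInClass R v → v ≢ b → LeastInClass (Merge R x y) v
      stays-least least-v v≢b u u<v (inj₁ uv) = least-v u u<v uv
      stays-least least-v v≢b u u<v (inj₂ (inj₁ (_ , yv))) =
        v≢b (sym (leastInClass-unique least-b least-v (by ∙ yv)))
      stays-least least-v v≢b u u<v (inj₂ (inj₂ (uy , xv)))
        with leastInClass-unique least-a least-v (ax ∙ xv)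
      ... | refl = below-b u (<-trans u<v a<b) uy

  #classes-merge : ∀ {x y} → ¬ R x y → #classes R? ≡ suc (#classes (merge? R? x y))
  #classes-merge {x} {y} ¬xy
    with least (λ w → R? w x) (R-refl {x}) | least (λ w → R? w y) (R-refl {y})
  ... | a , ax , below-a | b , by , below-b with <-cmp a b
  ... | tri< a<b _ _ = #classes-merge-< ax below-a by below-b a<b
  ... | tri≈ _ refl _ = contradiction (R-sym ax ∙ by) ¬xy
  ... | tri> _ _ b<a = trans (#classes-merge-< by below-b ax below-a b<a)
    (cong suc (#classes-cong (merge? R? y x) (merge? R? x y) (merge-swap {R = R}) (merge-swap {R = R})))

-- Finite subsets

x∈p∪⁅x⁆ : ∀ {n} (p : Subset n) x → x ∈ p ∪ ⁅ x ⁆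
x∈p∪⁅x⁆ p x = q⊆p∪q p ⁅ x ⁆ (x∈⁅x⁆ x)

x∈p∪⁅y⁆⁻ : ∀ {n} {p : Subset n} {x y} → x ∈ p ∪ ⁅ y ⁆ → x ∈ p ⊎ x ≡ y
x∈p∪⁅y⁆⁻ {p = p} {y = y} x∈ with x∈p∪q⁻ p ⁅ y ⁆ x∈
... | inj₁ x∈p = inj₁ x∈p
... | inj₂ x∈y = inj₂ (x∈⁅y⁆⇒x≡y y x∈y)

x∈p∪⁅y⁆∧y≢x⇒x∈p : ∀ {n} {p : Subset n} {x y} → x ∈ p ∪ ⁅ y ⁆ → y ≢ x → x ∈ p
x∈p∪⁅y⁆∧y≢x⇒x∈p x∈ y≢x with x∈p∪⁅y⁆⁻ x∈
... | inj₁ x∈p = x∈p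
... | inj₂ refl = contradiction refl y≢x

x∈p⇒p∪⁅x⁆≡p : ∀ {n} {x : Fin n} {p} → x ∈ p → p ∪ ⁅ x ⁆ ≡ p
x∈p⇒p∪⁅x⁆≡p {x = x} {p} x∈p = ⊆-antisym ⊆p (p⊆p∪q ⁅ x ⁆)
  where
  ⊆p : p ∪ ⁅ x ⁆ ⊆ p
  ⊆p e∈ with x∈p∪⁅y⁆⁻ e∈
  ... | inj₁ e∈p  = e∈p
  ... | inj₂ refl = x∈p

∣p∪⁅x⁆∣≡1+∣p∣ : ∀ {n} {x : Fin n} {p} → x ∉ p → ∣ p ∪ ⁅ x ⁆ ∣ ≡ suc ∣ p ∣
∣p∪⁅x⁆∣≡1+∣p∣ {x = zero}  {inside  ∷ p} x∉p = contradiction here x∉p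
∣p∪⁅x⁆∣≡1+∣p∣ {x = zero}  {outside ∷ p} _   = cong (suc ∘ ∣_∣) (∪-identityʳ p)
∣p∪⁅x⁆∣≡1+∣p∣ {x = suc x} {inside  ∷ p} x∉p = cong suc (∣p∪⁅x⁆∣≡1+∣p∣ (x∉p ∘ there))
∣p∪⁅x⁆∣≡1+∣p∣ {x = suc x} {outside ∷ p} x∉p = ∣p∪⁅x⁆∣≡1+∣p∣ (x∉p ∘ there)

subsetOf : ∀ {n} {P : Pred (Fin n) 0ℓ} → U.Decidable P → Subset n
subsetOf {zero}  P? = []
subsetOf {suc n} P? = (if does (P? zero) then inside else outside) ∷ subsetOf (P? ∘ suc)

∈-subsetOf⁺ : ∀ {n} {P : Pred (Fin n) 0ℓ} (P? : U.Decidable P) {x} → P x → x ∈ subsetOf P?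
∈-subsetOf⁺ P? {zero} px with P? zero
... | yes _  = here
... | no ¬p0 = contradiction px ¬p0
∈-subsetOf⁺ P? {suc x} px = there (∈-subsetOf⁺ (P? ∘ suc) px)

∈-subsetOf⁻ : ∀ {n} {P : Pred (Fin n) 0ℓ} (P? : U.Decidable P) {x} → x ∈ subsetOf P? → P x
∈-subsetOf⁻ P? {zero} x∈ with P? zero | x∈
... | yes p0 | _ = p0
... | no _   | ()
∈-subsetOf⁻ P? {suc x} (there x∈) = ∈-subsetOf⁻ (P? ∘ suc) x∈

infixl 6 _∪ₗ_
_∪ₗ_ : ∀ {n} → Subset n → List (Fin n) → Subset n
X ∪ₗ []       = X
X ∪ₗ (t ∷ ts) = (X ∪ₗ ts) ∪ ⁅ t ⁆

∈-∪ₗ⁻ : ∀ {n} {X : Subset n} ts {e} → e ∈ X ∪ₗ ts → e ∈ X ⊎ e ∈ₗ ts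
∈-∪ₗ⁻ []       e∈ = inj₁ e∈
∈-∪ₗ⁻ (t ∷ ts) e∈ with x∈p∪⁅y⁆⁻ e∈
... | inj₂ refl = inj₂ (hereₗ refl)
... | inj₁ e∈X∪ₗts with ∈-∪ₗ⁻ ts e∈X∪ₗts
...   | inj₁ e∈X  = inj₁ e∈X
...   | inj₂ e∈ts = inj₂ (thereₗ e∈ts)

∈-∪ₗ⁺ : ∀ {n} {X : Subset n} ts {e} → e ∈ X ⊎ e ∈ₗ ts → e ∈ X ∪ₗ ts
∈-∪ₗ⁺ []       (inj₁ e∈X)           = e∈X
∈-∪ₗ⁺ (t ∷ ts) (inj₁ e∈X)           = p⊆p∪q ⁅ t ⁆ (∈-∪ₗ⁺ ts (inj₁ e∈X))
∈-∪ₗ⁺ (t ∷ ts) (inj₂ (hereₗ refl))  = x∈p∪⁅x⁆ _ t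
∈-∪ₗ⁺ (t ∷ ts) (inj₂ (thereₗ e∈ts)) = p⊆p∪q ⁅ t ⁆ (∈-∪ₗ⁺ ts (inj₂ e∈ts))

∪ₗ-monoˡ : ∀ {n} {X Y : Subset n} ts → X ⊆ Y → X ∪ₗ ts ⊆ Y ∪ₗ ts
∪ₗ-monoˡ ts X⊆Y e∈ with ∈-∪ₗ⁻ ts e∈
... | inj₁ e∈X  = ∈-∪ₗ⁺ ts (inj₁ (X⊆Y e∈X))
... | inj₂ e∈ts = ∈-∪ₗ⁺ ts (inj₂ e∈ts)

elements : ∀ {n} → Subset n → List (Fin n)
elements {n} X = filter (_∈? X) (allFin n)

∈-elements⁻ : ∀ {n} {X : Subset n} {e} → e ∈ₗ elements X → e ∈ X
∈-elements⁻ {n} {X} e∈ = proj₂ (∈-filter⁻ (_∈? X) {xs = allFin n} e∈)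

∪ₗ-elements : ∀ {n} (X Y : Subset n) → X ∪ₗ elements Y ≡ X ∪ Y
∪ₗ-elements X Y = ⊆-antisym ⊆∪ ∪⊆
  where
  ⊆∪ : X ∪ₗ elements Y ⊆ X ∪ Y
  ⊆∪ e∈ with ∈-∪ₗ⁻ (elements Y) e∈
  ... | inj₁ e∈X = x∈p∪q⁺ (inj₁ e∈X)
  ... | inj₂ e∈ₗ = x∈p∪q⁺ (inj₂ (∈-elements⁻ e∈ₗ))
  ∪⊆ : X ∪ Y ⊆ X ∪ₗ elements Y
  ∪⊆ {e} e∈ with x∈p∪q⁻ X Y e∈
  ... | inj₁ e∈X = ∈-∪ₗ⁺ (elements Y) (inj₁ e∈X)
  ... | inj₂ e∈Y = ∈-∪ₗ⁺ (elements Y) (inj₂ (∈-filter⁺ (_∈? Y) (∈-allFin e) e∈Y))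

⊥∪ₗelements : ∀ {n} (X : Subset n) → ⊥ ∪ₗ elements X ≡ X
⊥∪ₗelements X = trans (∪ₗ-elements ⊥ X) (∪-identityˡ X)

-- Connectivity, cycles and ranks in a graph

module _ (G : Graph) where
  open Graph G

  src tgt : Fin nE → Fin nV
  src e = proj₁ (ends e)
  tgt e = proj₂ (ends e)

  Step : Subset nE → Rel (Fin nV) 0ℓ
  Step X u w = ∃ λ e → e ∈ X × Joins G e u w

  Conn : Subset nE → Rel (Fin nV) 0ℓ
  Conn X = Star (Step X)

  joins-sym : ∀ {e u w} → Joins G e u w → Joins G e w u
  joins-sym (inj₁ e≡uw) = inj₂ e≡uw
  joins-sym (inj₂ e≡wu) = inj₁ e≡wu

  joins-transport : ∀ {R : Rel (Fin nV) 0ℓ} → (∀ {u w} → R u w → R w u) →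
                    ∀ {e u w p q} → Joins G e u w → Joins G e p q → R u w → R p q
  joins-transport R-sym (inj₁ e≡uw) (inj₁ e≡pq) r with trans (sym e≡uw) e≡pq
  ... | refl = r
  joins-transport R-sym (inj₁ e≡uw) (inj₂ e≡qp) r with trans (sym e≡uw) e≡qp
  ... | refl = R-sym r
  joins-transport R-sym (inj₂ e≡wu) (inj₁ e≡pq) r with trans (sym e≡wu) e≡pq
  ... | refl = R-sym r
  joins-transport R-sym (inj₂ e≡wu) (inj₂ e≡qp) r with trans (sym e≡wu) e≡qp
  ... | refl = r

  conn-sym : ∀ {X u v} → Conn X u v → Conn X v u
  conn-sym = Star.reverse λ (e , e∈X , j) → e , e∈X , joins-sym j

  conn-isEquivalence : ∀ X → IsEquivalence (Conn X)
  conn-isEquivalence X = record { refl = ε ; sym = conn-sym ; trans = _◅◅_ }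

  conn-edge : ∀ {X e} → e ∈ X → Conn X (src e) (tgt e)
  conn-edge e∈X = Star.return (_ , e∈X , inj₁ refl)

  conn-joins : ∀ {X e u w} → Joins G e u w → Conn X (src e) (tgt e) → Conn X u w
  conn-joins j = joins-transport conn-sym (inj₁ refl) j

  conn-spans : ∀ {X Y} → (∀ {e} → e ∈ X → Conn Y (src e) (tgt e)) → Conn X ⇒ Conn Y
  conn-spans spans = (λ (e , e∈X , j) → conn-joins j (spans e∈X)) Star.⋆

  conn-mono : ∀ {X Y} → X ⊆ Y → Conn X ⇒ Conn Y
  conn-mono X⊆Y = Star.map λ (e , e∈X , j) → e , X⊆Y e∈X , j

  conn-∪⁅⁆⇒merge : ∀ {X f} → Conn (X ∪ ⁅ f ⁆) ⇒ Merge (Conn X) (src f) (tgt f)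
  conn-∪⁅⁆⇒merge ε = inj₁ ε
  conn-∪⁅⁆⇒merge {X} ((e , e∈ , j) ◅ c) with x∈p∪⁅y⁆⁻ e∈
  ... | inj₁ e∈X  = merge-trans (conn-isEquivalence X) (inj₁ (Star.return (e , e∈X , j))) (conn-∪⁅⁆⇒merge c)
  ... | inj₂ refl = merge-trans (conn-isEquivalence X) (joins-merge j) (conn-∪⁅⁆⇒merge c)
    where
    joins-merge : ∀ {u w} → Joins G e u w → Merge (Conn X) (src e) (tgt e) u w
    joins-merge (inj₁ refl) = inj₂ (inj₁ (ε , ε))
    joins-merge (inj₂ refl) = inj₂ (inj₂ (ε , ε))

  merge⇒conn-∪⁅⁆ : ∀ {X f} → Merge (Conn X) (src f) (tgt f) ⇒ Conn (X ∪ ⁅ f ⁆)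
  merge⇒conn-∪⁅⁆ {X} {f} = λ
    { (inj₁ uv)               → ⊆∪f uv
    ; (inj₂ (inj₁ (ux , yv))) → ⊆∪f ux ◅◅ conn-edge (x∈p∪⁅x⁆ X f) ◅◅ ⊆∪f yv
    ; (inj₂ (inj₂ (uy , xv))) → ⊆∪f uy ◅◅ conn-sym (conn-edge (x∈p∪⁅x⁆ X f)) ◅◅ ⊆∪f xv
    }
    where
    ⊆∪f : Conn X ⇒ Conn (X ∪ ⁅ f ⁆)
    ⊆∪f = conn-mono (p⊆p∪q ⁅ f ⁆)

  conn-⊥ : Conn ⊥ ⇒ _≡_
  conn-⊥ ε                   = refl
  conn-⊥ ((_ , e∈⊥ , _) ◅ _) = contradiction e∈⊥ ∉⊥

  conn? : ∀ X → Decidable (Conn X)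
  conn? X = subst (Decidable ∘ Conn) (⊥∪ₗelements X) (conn-∪ₗ? (elements X))
    where
    conn-∪ₗ? : ∀ ts → Decidable (Conn (⊥ ∪ₗ ts))
    conn-∪ₗ? []       u v = map′ (λ { refl → ε }) conn-⊥ (u ≟ v)
    conn-∪ₗ? (t ∷ ts) u v =
      map′ merge⇒conn-∪⁅⁆ conn-∪⁅⁆⇒merge (merge? (conn-∪ₗ? ts) (src t) (tgt t) u v)

  components : Subset nE → ℕ
  components X = #classes (conn? X)

  components-antitone : ∀ {X Y} → Conn X ⇒ Conn Y → components Y ℕ.≤ components X
  components-antitone = #classes-antitone (conn? _) (conn? _)

  components-cong : ∀ {X Y} → Conn X ⇒ Conn Y → Conn Y ⇒ Conn X → components X ≡ components Y
  components-cong = #classes-cong (conn? _) (conn? _)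

  components-⊥ : components ⊥ ≡ nV
  components-⊥ = #classes-discrete (conn? ⊥) conn-⊥

  conn-∪⁅⁆-conn : ∀ {X f} → Conn X (src f) (tgt f) → Conn (X ∪ ⁅ f ⁆) ⇒ Conn X
  conn-∪⁅⁆-conn {X} {f} cf = conn-spans spans
    where
    spans : ∀ {e} → e ∈ X ∪ ⁅ f ⁆ → Conn X (src e) (tgt e)
    spans e∈ with x∈p∪⁅y⁆⁻ e∈
    ... | inj₁ e∈X  = conn-edge e∈X
    ... | inj₂ refl = cf

  conn-∪⁅⁆-mono : ∀ {X Y f} → Conn X ⇒ Conn Y → Conn (X ∪ ⁅ f ⁆) ⇒ Conn (Y ∪ ⁅ f ⁆)
  conn-∪⁅⁆-mono {X} {Y} {f} X⇒Y = conn-spans spans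
    where
    spans : ∀ {e} → e ∈ X ∪ ⁅ f ⁆ → Conn (Y ∪ ⁅ f ⁆) (src e) (tgt e)
    spans e∈ with x∈p∪⁅y⁆⁻ e∈
    ... | inj₁ e∈X  = conn-mono (p⊆p∪q ⁅ f ⁆) (X⇒Y (conn-edge e∈X))
    ... | inj₂ refl = conn-edge (x∈p∪⁅x⁆ Y f)

  components-∪⁅⁆-conn : ∀ {X f} → Conn X (src f) (tgt f) → components (X ∪ ⁅ f ⁆) ≡ components X
  components-∪⁅⁆-conn {f = f} cf = components-cong (conn-∪⁅⁆-conn cf) (conn-mono (p⊆p∪q ⁅ f ⁆))

  components-∪⁅⁆-bridge : ∀ {X f} → ¬ Conn X (src f) (tgt f) → components X ≡ suc (components (X ∪ ⁅ f ⁆))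
  components-∪⁅⁆-bridge {X} {f} ¬cf =
    trans (#classes-merge (conn? X) (conn-isEquivalence X) ¬cf)
          (cong suc (#classes-cong (merge? (conn? X) _ _) (conn? _) merge⇒conn-∪⁅⁆ conn-∪⁅⁆⇒merge))

  hasCycle-mono : ∀ {X Y} → X ⊆ Y → HasCycle G X → HasCycle G Y
  hasCycle-mono X⊆Y (u , e , es , W , U , A) = u , e , es , W , U , All.map X⊆Y A

  walk⇒conn : ∀ {X u v es} → Walk G u v es → All (_∈ X) es → Conn X u v
  walk⇒conn nil         []          = ε
  walk⇒conn (cons j W) (e∈X ∷ A)    = (_ , e∈X , j) ◅ walk⇒conn W A

  all-∈-∪⁅⁆-avoiding : ∀ {X : Subset nE} {f es} → All (f ≢_) es → All (_∈ X ∪ ⁅ f ⁆) es → All (_∈ X) es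
  all-∈-∪⁅⁆-avoiding f≢es A = All.zipWith (λ (f≢e , e∈) → x∈p∪⁅y⁆∧y≢x⇒x∈p e∈ f≢e) (f≢es , A)

  trail-through : ∀ {X f u v es} → Walk G u v es → All (_∈ X ∪ ⁅ f ⁆) es → Unique es → f ∈ₗ es →
                  ∃ λ a → ∃ λ b → Joins G f a b × Conn X u a × Conn X b v
  trail-through (cons j W) (_ ∷ A) (f≢es ∷ _) (hereₗ refl) =
    _ , _ , j , ε , walk⇒conn W (all-∈-∪⁅⁆-avoiding f≢es A)
  trail-through (cons j W) (e∈ ∷ A) (e≢es ∷ U) (thereₗ f∈es) with trail-through W A U f∈es
  ... | a , b , jf , ua , bv = a , b , jf , (_ , e∈X , j) ◅ ua , bv
    where e∈X = x∈p∪⁅y⁆∧y≢x⇒x∈p e∈ λ f≡e → All.lookup e≢es f∈es (sym f≡e)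

  cycle⇒conn : ∀ {X f} → ¬ HasCycle G X → HasCycle G (X ∪ ⁅ f ⁆) → Conn X (src f) (tgt f)
  cycle⇒conn {X} {f} acyclic (u , e , es , W , U , A) with any? (f ≟_) (e ∷ es)
  ... | no f∉ = contradiction (u , e , es , W , U , all-∈-∪⁅⁆-avoiding (¬Any⇒All¬ _ f∉) A) acyclic
  ... | yes f∈ with trail-through W A U f∈
  ...   | a , b , jf , ua , bu = joins-transport conn-sym jf (inj₁ refl) (conn-sym (bu ◅◅ ua))

  -- A walk together with the list of the vertices it visits, which are pairwise distinct.
  data Path : Fin nV → Fin nV → List (Fin nE) → List (Fin nV) → Set where
    pnil  : ∀ {u} → Path u u [] (u ∷ [])
    pcons : ∀ {u w v e es vs} → Joins G e u w → u ∉ₗ vs → Path w v es vs → Path u v (e ∷ es) (u ∷ vs)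

  path⇒walk : ∀ {u v es vs} → Path u v es vs → Walk G u v es
  path⇒walk pnil           = nil
  path⇒walk (pcons j _ P)  = cons j (path⇒walk P)

  path-start : ∀ {u v es vs} → Path u v es vs → u ∈ₗ vs
  path-start pnil          = hereₗ refl
  path-start (pcons _ _ _) = hereₗ refl

  path-edge-ends : ∀ {u v es vs e} → Path u v es vs → e ∈ₗ es →
                   ∃ λ p → ∃ λ q → Joins G e p q × p ∈ₗ vs × q ∈ₗ vs
  path-edge-ends (pcons j _ P) (hereₗ refl) = _ , _ , j , hereₗ refl , thereₗ (path-start P)
  path-edge-ends (pcons j _ P) (thereₗ e∈es) with path-edge-ends P e∈es
  ... | p , q , j′ , p∈ , q∈ = p , q , j′ , thereₗ p∈ , thereₗ q∈

  joins-end : ∀ {e u w p q} → Joins G e u w → Joins G e p q → u ≡ p ⊎ u ≡ q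
  joins-end (inj₁ e≡uw) (inj₁ e≡pq) = inj₁ (cong proj₁ (trans (sym e≡uw) e≡pq))
  joins-end (inj₁ e≡uw) (inj₂ e≡qp) = inj₂ (cong proj₁ (trans (sym e≡uw) e≡qp))
  joins-end (inj₂ e≡wu) (inj₁ e≡pq) = inj₂ (cong proj₂ (trans (sym e≡wu) e≡pq))
  joins-end (inj₂ e≡wu) (inj₂ e≡qp) = inj₁ (cong proj₂ (trans (sym e≡wu) e≡qp))

  -- An edge occurring later in the path has both ends among the later vertices, so not at u.
  path-unique : ∀ {u v es vs} → Path u v es vs → Unique es
  path-unique pnil = []
  path-unique (pcons {e = e} j u∉vs P) = All.tabulate e≢later ∷ path-unique P
    where
    e≢later : ∀ {e′} → e′ ∈ₗ _ → e ≢ e′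
    e≢later e′∈ refl with path-edge-ends P e′∈
    ... | p , q , j′ , p∈ , q∈ with joins-end j j′
    ...   | inj₁ refl = u∉vs p∈
    ...   | inj₂ refl = u∉vs q∈

  path-suffix : ∀ {X u v w es vs} → Path w v es vs → All (_∈ X) es → u ∈ₗ vs →
                ∃ λ es′ → ∃ λ vs′ → Path u v es′ vs′ × All (_∈ X) es′
  path-suffix pnil          A       (hereₗ refl) = _ , _ , pnil , A
  path-suffix (pcons j u∉ P) A      (hereₗ refl) = _ , _ , pcons j u∉ P , A
  path-suffix (pcons _ _ P) (_ ∷ A) (thereₗ u∈) = path-suffix P A u∈

  -- Loops are cut out as soon as a vertex repeats.
  conn⇒path : ∀ {X u v} → Conn X u v → ∃ λ es → ∃ λ vs → Path u v es vs × All (_∈ X) es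
  conn⇒path ε = [] , _ , pnil , []
  conn⇒path {u = u} ((_ , e∈X , j) ◅ c) with conn⇒path c
  ... | es , vs , P , A with any? (u ≟_) vs
  ...   | yes u∈vs = path-suffix P A u∈vs
  ...   | no u∉vs  = _ , _ , pcons j u∉vs P , e∈X ∷ A

  conn⇒cycle : ∀ {X f} → f ∉ X → Conn X (src f) (tgt f) → HasCycle G (X ∪ ⁅ f ⁆)
  conn⇒cycle {X} {f} f∉X c with conn⇒path (conn-sym c)
  ... | es , vs , P , A =
    src f , f , es , cons (inj₁ refl) (path⇒walk P) ,
    All.map (λ e∈X f≡e → f∉X (subst (_∈ X) (sym f≡e) e∈X)) A ∷ path-unique P ,
    x∈p∪⁅x⁆ X f ∷ All.map (p⊆p∪q ⁅ f ⁆) A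

  forest-size : ∀ {I} → ¬ HasCycle G I → ∣ I ∣ + components I ≡ nV
  forest-size {I} =
    subst (λ I → ¬ HasCycle G I → ∣ I ∣ + components I ≡ nV) (⊥∪ₗelements I) (forest-∪ₗ (elements I))
    where
    open ≡-Reasoning
    forest-∪ₗ : ∀ ts → ¬ HasCycle G (⊥ ∪ₗ ts) → ∣ ⊥ ∪ₗ ts ∣ + components (⊥ ∪ₗ ts) ≡ nV
    forest-∪ₗ []       _       = cong₂ _+_ (∣⊥∣≡0 nE) components-⊥
    forest-∪ₗ (t ∷ ts) acyclic with t ∈? (⊥ ∪ₗ ts)
    ... | yes t∈X = subst (λ Y → ¬ HasCycle G Y → ∣ Y ∣ + components Y ≡ nV)
                          (sym (x∈p⇒p∪⁅x⁆≡p t∈X)) (forest-∪ₗ ts) acyclic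
    ... | no t∉X = begin
      ∣ X ∪ ⁅ t ⁆ ∣ + components (X ∪ ⁅ t ⁆)  ≡⟨ cong (_+ components (X ∪ ⁅ t ⁆)) (∣p∪⁅x⁆∣≡1+∣p∣ t∉X) ⟩
      suc ∣ X ∣ + components (X ∪ ⁅ t ⁆)      ≡⟨ sym (ℕ.+-suc ∣ X ∣ _) ⟩
      ∣ X ∣ + suc (components (X ∪ ⁅ t ⁆))    ≡⟨ cong (∣ X ∣ +_) (sym (components-∪⁅⁆-bridge bridge)) ⟩
      ∣ X ∣ + components X                    ≡⟨ forest-∪ₗ ts (acyclic ∘ hasCycle-mono (p⊆p∪q ⁅ t ⁆)) ⟩
      nV                                      ∎
      where
      X = ⊥ ∪ₗ ts
      bridge : ¬ Conn X (src t) (tgt t)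
      bridge = acyclic ∘ conn⇒cycle t∉X

  SpanningForest : Subset nE → Subset nE → Set
  SpanningForest X J = J ⊆ X × ¬ HasCycle G J × Conn X ⇒ Conn J

  spanningForest : ∀ X → ∃ (SpanningForest X)
  spanningForest X = subst (∃ ∘ SpanningForest) (⊥∪ₗelements X) (grow (elements X))
    where
    grow : ∀ ts → ∃ (SpanningForest (⊥ ∪ₗ ts))
    grow [] = ⊥ , id , (λ { (_ , _ , _ , _ , _ , e∈⊥ ∷ _) → ∉⊥ e∈⊥ }) , id
    grow (t ∷ ts) with grow ts
    ... | J , J⊆X , acyclic , spans with conn? J (src t) (tgt t)
    ...   | yes c = J , p⊆p∪q ⁅ t ⁆ ∘ J⊆X , acyclic , conn-∪⁅⁆-conn c ∘ conn-∪⁅⁆-mono spans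
    ...   | no ¬c = J ∪ ⁅ t ⁆ , ∪ₗ-monoˡ (t ∷ []) J⊆X , ¬c ∘ cycle⇒conn acyclic , conn-∪⁅⁆-mono spans

  open MatroidNotions (CycleIndep G)

  independent-size : ∀ {X I} → I ⊆ X → ¬ HasCycle G I → ∣ I ∣ + components X ℕ.≤ nV
  independent-size {X} {I} I⊆X acyclic = begin
    ∣ I ∣ + components X  ≤⟨ ℕ.+-monoʳ-≤ ∣ I ∣ (components-antitone (conn-mono I⊆X)) ⟩
    ∣ I ∣ + components I  ≡⟨ forest-size acyclic ⟩
    nV                    ∎
    where open ℕ.≤-Reasoning

  spanningForest-size : ∀ {X J} → SpanningForest X J → ∣ J ∣ + components X ≡ nV
  spanningForest-size {J = J} (J⊆X , acyclic , spans) =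
    trans (cong (∣ J ∣ +_) (components-cong spans (conn-mono J⊆X))) (forest-size acyclic)

  rank-exists : ∀ X → ∃ (Rank X)
  rank-exists X with spanningForest X
  ... | J , forest@(J⊆X , acyclic , _) = ∣ J ∣ , (J , J⊆X , acyclic , refl) , maximal
    where
    maximal : ∀ I → I ⊆ X → CycleIndep G I → ∣ I ∣ ℕ.≤ ∣ J ∣
    maximal I I⊆X acyclic′ = ℕ.+-cancelʳ-≤ (components X) ∣ I ∣ ∣ J ∣
      (ℕ.≤-trans (independent-size I⊆X acyclic′) (ℕ.≤-reflexive (sym (spanningForest-size forest))))

  rank-components : ∀ {X k} → Rank X k → k + components X ≡ nV
  rank-components {X} {k} ((I , I⊆X , acyclic , ∣I∣≡k) , maximal) with spanningForest X
  ... | J , forest@(J⊆X , acyclic′ , _) = ℕ.≤-antisym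
    (subst (λ m → m + components X ℕ.≤ nV) ∣I∣≡k (independent-size I⊆X acyclic))
    (begin
      nV                    ≡⟨ sym (spanningForest-size forest) ⟩
      ∣ J ∣ + components X  ≤⟨ ℕ.+-monoˡ-≤ (components X) (maximal J J⊆X acyclic′) ⟩
      k + components X      ∎)
    where open ℕ.≤-Reasoning

  rank-∪⁅⁆-conn : ∀ {X e a b} → Conn X (src e) (tgt e) → Rank X a → Rank (X ∪ ⁅ e ⁆) b → a ≡ b
  rank-∪⁅⁆-conn {X} {e} {a} {b} c ra rb = ℕ.+-cancelʳ-≡ (components X) a b (begin
    a + components X            ≡⟨ rank-components ra ⟩
    nV                          ≡⟨ sym (rank-components rb) ⟩
    b + components (X ∪ ⁅ e ⁆)  ≡⟨ cong (b +_) (components-∪⁅⁆-conn c) ⟩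
    b + components X            ∎)
    where open ≡-Reasoning

  rank-∪⁅⁆-bridge : ∀ {X e a b} → ¬ Conn X (src e) (tgt e) → Rank X a → Rank (X ∪ ⁅ e ⁆) b → suc a ≡ b
  rank-∪⁅⁆-bridge {X} {e} {a} {b} ¬c ra rb = ℕ.+-cancelʳ-≡ (components (X ∪ ⁅ e ⁆)) (suc a) b (begin
    suc a + components (X ∪ ⁅ e ⁆)  ≡⟨ sym (ℕ.+-suc a _) ⟩
    a + suc (components (X ∪ ⁅ e ⁆)) ≡⟨ cong (a +_) (sym (components-∪⁅⁆-bridge ¬c)) ⟩
    a + components X                ≡⟨ rank-components ra ⟩
    nV                              ≡⟨ sym (rank-components rb) ⟩
    b + components (X ∪ ⁅ e ⁆)      ∎)
    where open ≡-Reasoning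

  flat-closed : ∀ {F e} → Flat F → Conn F (src e) (tgt e) → e ∈ F
  flat-closed {F} {e} (_ , rank-increases) c with e ∈? F
  ... | yes e∈F = e∈F
  ... | no e∉F with rank-exists F | rank-exists (F ∪ ⁅ e ⁆)
  ...   | a , ra | b , rb =
    contradiction (rank-∪⁅⁆-conn c ra rb) (ℕ.<⇒≢ (rank-increases e ∈⊤ e∉F a b ra rb))

  flatIn-intro : ∀ {F X} → X ⊆ F → (∀ e → e ∈ F → e ∉ X → ¬ Conn X (src e) (tgt e)) → FlatIn F X
  flatIn-intro X⊆F bridges = X⊆F , λ e e∈F e∉X a b ra rb →
    ℕ.≤-reflexive (rank-∪⁅⁆-bridge (bridges e e∈F e∉X) ra rb)

  -- Round flats

  NonLoopAt : Fin nV → Fin nE → Set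
  NonLoopAt u e = src e ≢ tgt e × (src e ≡ u ⊎ tgt e ≡ u)

  nonLoopAt? : ∀ u → U.Decidable (NonLoopAt u)
  nonLoopAt? u e = ¬? (src e ≟ tgt e) ×-dec (src e ≟ u ⊎-dec tgt e ≟ u)

  Touches : Subset nE → Fin nV → Set
  Touches F u = ∃ λ e → e ∈ F × NonLoopAt u e

  loop-or-touches : ∀ {F e} → e ∈ F → src e ≡ tgt e ⊎ (Touches F (src e) × Touches F (tgt e))
  loop-or-touches {e = e} e∈F with src e ≟ tgt e
  ... | yes loop   = inj₁ loop
  ... | no nonloop = inj₂ ((e , e∈F , nonloop , inj₁ refl) , (e , e∈F , nonloop , inj₂ refl))

  joins-nonLoopAt : ∀ {e u w} → Joins G e u w → w ≢ u → NonLoopAt u e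
  joins-nonLoopAt (inj₁ e≡uw) w≢u =
    (λ s≡t → w≢u (trans (sym (cong proj₂ e≡uw)) (trans (sym s≡t) (cong proj₁ e≡uw)))) , inj₁ (cong proj₁ e≡uw)
  joins-nonLoopAt (inj₂ e≡wu) w≢u =
    (λ s≡t → w≢u (trans (sym (cong proj₁ e≡wu)) (trans s≡t (cong proj₂ e≡wu)))) , inj₂ (cong proj₂ e≡wu)

  nonLoopAt-joins : ∀ {e u v} → NonLoopAt u e → NonLoopAt v e → u ≢ v → Joins G e u v
  nonLoopAt-joins (_ , inj₁ s≡u) (_ , inj₁ s≡v) u≢v = contradiction (trans (sym s≡u) s≡v) u≢v
  nonLoopAt-joins (_ , inj₁ s≡u) (_ , inj₂ t≡v) u≢v = inj₁ (cong₂ _,_ s≡u t≡v)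
  nonLoopAt-joins (_ , inj₂ t≡u) (_ , inj₁ s≡v) u≢v = inj₂ (cong₂ _,_ s≡v t≡u)
  nonLoopAt-joins (_ , inj₂ t≡u) (_ , inj₂ t≡v) u≢v = contradiction (trans (sym t≡u) t≡v) u≢v

  isolated : ∀ {X u} → (∀ {e w} → e ∈ X → Joins G e u w → w ≡ u) → ∀ {z} → Conn X u z → z ≡ u
  isolated stays ε = refl
  isolated stays ((_ , e∈X , j) ◅ c) with stays e∈X j
  ... | refl = isolated stays c

  deleteStar : Subset nE → Fin nV → Subset nE
  deleteStar F u = subsetOf λ e → e ∈? F ×-dec ¬? (nonLoopAt? u e)

  deleteStar-flatIn : ∀ F u → FlatIn F (deleteStar F u)
  deleteStar-flatIn F u = flatIn-intro (proj₁ ∘ ∈-subsetOf⁻ _) separates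
    where
    u-isolated : ∀ {z} → Conn (deleteStar F u) u z → z ≡ u
    u-isolated = isolated λ {_} {w} e∈ j → decidable-stable (w ≟ u)
      λ w≢u → proj₂ (∈-subsetOf⁻ _ e∈) (joins-nonLoopAt j w≢u)
    separates : ∀ e → e ∈ F → e ∉ deleteStar F u → ¬ Conn (deleteStar F u) (src e) (tgt e)
    separates e e∈F e∉ c with nonLoopAt? u e
    ... | no ¬at                       = e∉ (∈-subsetOf⁺ _ (e∈F , ¬at))
    ... | yes (nonloop , inj₁ refl)    = nonloop (sym (u-isolated c))
    ... | yes (nonloop , inj₂ refl)    = nonloop (u-isolated (conn-sym c))

  deleteStar≢ : ∀ {F u} → Touches F u → deleteStar F u ≢ F
  deleteStar≢ (e , e∈F , at) F∖u≡F = proj₂ (∈-subsetOf⁻ _ (subst (e ∈_) (sym F∖u≡F) e∈F)) at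

  -- Otherwise the flats obtained by deleting the non-loop edges at u, resp. at v, cover F.
  round-clique : ∀ {F u v} → Round F → Touches F u → Touches F v → u ≢ v →
                 ∃ λ e → e ∈ F × Joins G e u v
  round-clique {F} {u} {v} (_ , uncovered) tu tv u≢v
    with ∃? (λ e → e ∈? F ×-dec nonLoopAt? u e ×-dec nonLoopAt? v e)
  ... | yes (e , e∈F , at-u , at-v) = e , e∈F , nonLoopAt-joins at-u at-v u≢v
  ... | no ¬both = contradiction
    (deleteStar-flatIn F u , deleteStar-flatIn F v , deleteStar≢ tu , deleteStar≢ tv , ⊆-antisym ⊆F F⊆)
    (uncovered (deleteStar F u) (deleteStar F v))
    where
    ⊆F : deleteStar F u ∪ deleteStar F v ⊆ F
    ⊆F e∈ with x∈p∪q⁻ (deleteStar F u) _ e∈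
    ... | inj₁ e∈F∖u = proj₁ (∈-subsetOf⁻ _ e∈F∖u)
    ... | inj₂ e∈F∖v = proj₁ (∈-subsetOf⁻ _ e∈F∖v)
    F⊆ : F ⊆ deleteStar F u ∪ deleteStar F v
    F⊆ {e} e∈F with nonLoopAt? u e | nonLoopAt? v e
    ... | no ¬at-u | _        = x∈p∪q⁺ (inj₁ (∈-subsetOf⁺ _ (e∈F , ¬at-u)))
    ... | yes _    | no ¬at-v = x∈p∪q⁺ (inj₂ (∈-subsetOf⁺ _ (e∈F , ¬at-v)))
    ... | yes at-u | yes at-v = contradiction (e , e∈F , at-u , at-v) ¬both

  -- Adding the edges of ts one at a time, the hypothesis makes each edge join two components over A
  -- exactly when it does over B, so both counts drop at the same steps.
  components-∪ₗ-exchange :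
    ∀ {A B T} → A ⊆ B →
    (∀ {ts t} → All (_∈ T) ts → t ∈ T → Conn (B ∪ₗ ts) (src t) (tgt t) → Conn (A ∪ₗ ts) (src t) (tgt t)) →
    ∀ {ts} → All (_∈ T) ts → components (A ∪ₗ ts) + components B ≡ components A + components (B ∪ₗ ts)
  components-∪ₗ-exchange A⊆B transfer [] = refl
  components-∪ₗ-exchange {A} {B} A⊆B transfer {t ∷ ts} (t∈T ∷ ts∈T) =
    step (conn? (B ∪ₗ ts) (src t) (tgt t))
    where
    open ≡-Reasoning
    ih = components-∪ₗ-exchange A⊆B transfer ts∈T
    A′ = (A ∪ₗ ts) ∪ ⁅ t ⁆
    B′ = (B ∪ₗ ts) ∪ ⁅ t ⁆
    step : Dec (Conn (B ∪ₗ ts) (src t) (tgt t)) → components A′ + components B ≡ components A + components B′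
    step (yes cB) = begin
      components A′ + components B          ≡⟨ cong (_+ components B) (components-∪⁅⁆-conn (transfer ts∈T t∈T cB)) ⟩
      components (A ∪ₗ ts) + components B   ≡⟨ ih ⟩
      components A + components (B ∪ₗ ts)  ≡⟨ cong (components A +_) (sym (components-∪⁅⁆-conn cB)) ⟩
      components A + components B′          ∎
    step (no ¬cB) = ℕ.suc-injective (begin
      suc (components A′ + components B)    ≡⟨ cong (_+ components B) (sym (components-∪⁅⁆-bridge ¬cA)) ⟩
      components (A ∪ₗ ts) + components B   ≡⟨ ih ⟩
      components A + components (B ∪ₗ ts)  ≡⟨ cong (components A +_) (components-∪⁅⁆-bridge ¬cB) ⟩
      components A + suc (components B′)    ≡⟨ ℕ.+-suc (components A) _ ⟩
      suc (components A + components B′)    ∎)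
      where
      ¬cA : ¬ Conn (A ∪ₗ ts) (src t) (tgt t)
      ¬cA = ¬cB ∘ conn-mono (∪ₗ-monoˡ ts A⊆B)

  module _ {F F′} (round : Round F) (flat′ : Flat F′) where

    -- In the base case, touched vertices connected in F′ are adjacent by an edge of F, which the flat F′ contains.
    round-conn : ∀ {ts} → All (_∈ F) ts → ∀ {u v} → Touches F u → Touches F v →
                 Conn (F′ ∪ₗ ts) u v → Conn ((F ∩ F′) ∪ₗ ts) u v
    round-conn [] {u} {v} tu tv c with u ≟ v
    ... | yes refl = ε
    ... | no u≢v with round-clique round tu tv u≢v
    ...   | e , e∈F , j = Star.return (e , x∈p∩q⁺ (e∈F , e∈F′) , j)
      where e∈F′ = flat-closed flat′ (joins-transport conn-sym j (inj₁ refl) c)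
    round-conn {t ∷ ts} (t∈F ∷ ts∈F) tu tv c with loop-or-touches t∈F
    ... | inj₁ loop =
      conn-mono (p⊆p∪q ⁅ t ⁆) (round-conn ts∈F tu tv (conn-∪⁅⁆-conn (subst (Conn _ (src t)) loop ε) c))
    ... | inj₂ (tx , ty) =
      merge⇒conn-∪⁅⁆ (merge-map (Touches F) (round-conn ts∈F) tx ty tu tv (conn-∪⁅⁆⇒merge c))

    round-components-modular : components F + components F′ ≡ components (F ∩ F′) + components (F ∪ F′)
    round-components-modular =
      subst₂ (λ X Y → components X + components F′ ≡ components (F ∩ F′) + components Y) ∩∪F≡F F′∪F≡F∪F′
        (components-∪ₗ-exchange (p∩q⊆q F F′) transfer (All.tabulate ∈-elements⁻))
      where
      transfer : ∀ {ts t} → All (_∈ F) ts → t ∈ F →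
                 Conn (F′ ∪ₗ ts) (src t) (tgt t) → Conn ((F ∩ F′) ∪ₗ ts) (src t) (tgt t)
      transfer {t = t} ts∈F t∈F c with loop-or-touches t∈F
      ... | inj₁ loop      = subst (Conn _ (src t)) loop ε
      ... | inj₂ (tx , ty) = round-conn ts∈F tx ty c
      ∩∪F≡F : (F ∩ F′) ∪ₗ elements F ≡ F
      ∩∪F≡F = trans (∪ₗ-elements (F ∩ F′) F) (⊆-antisym ⊆F (q⊆p∪q (F ∩ F′) F))
        where
        ⊆F : (F ∩ F′) ∪ F ⊆ F
        ⊆F e∈ with x∈p∪q⁻ (F ∩ F′) F e∈
        ... | inj₁ e∈F∩F′ = p∩q⊆p F F′ e∈F∩F′
        ... | inj₂ e∈F    = e∈F
      F′∪F≡F∪F′ : F′ ∪ₗ elements F ≡ F ∪ F′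
      F′∪F≡F∪F′ = trans (∪ₗ-elements F′ F) (∪-comm F′ F)

  round⇒modular : ∀ {F} → Round F → Modular F
  round⇒modular {F} round = proj₁ round , λ F′ flat′ a b c d ra rb rc rd →
    ℕ.+-cancelʳ-≡ (components F + components F′) (a + b) (c + d) (begin
      (a + b) + (components F + components F′)
        ≡⟨ interchange a b _ _ ⟩
      (a + components F) + (b + components F′)
        ≡⟨ cong₂ _+_ (rank-components ra) (rank-components rb) ⟩
      nV + nV
        ≡⟨ sym (cong₂ _+_ (rank-components rc) (rank-components rd)) ⟩
      (c + components (F ∩ F′)) + (d + components (F ∪ F′))
        ≡⟨ sym (interchange c d _ _) ⟩
      (c + d) + (components (F ∩ F′) + components (F ∪ F′))
        ≡⟨ cong ((c + d) +_) (sym (round-components-modular round flat′)) ⟩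
      (c + d) + (components F + components F′) ∎)
    where open ≡-Reasoning

mainTheorem11 : (G : Graph) → CycleMatroidSaturated G
mainTheorem11 G F = round⇒modular G
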